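{- Let $k\ge 3$ and let $H$ be a $k$-uniform hypergraph on the vertex set $[n]$, and let $v$ be a vertex of $H$. Suppose that the edge set of $H$ consists of all $k$-element subsets of $[n]$ containing $v$. Then the coloring complex $\Lambda(H)$ is shellable.
   Context: For a hypergraph $H$ on $[n]$, the coloring complex $\Lambda(H)$ is the simplicial complex whose $r$-faces are ordered set partitions $(B_1,\dots,B_{r+2})$ of $[n]$ into nonempty blocks such that at least one block contains a hyperedge of $H$; equivalently, faces are chains $\emptyset\subsetneq S_1\subsetneq\dots\subsetneq S_{r+1}\subsetneq[n]$ ($S_i=B_1\cup\dots\cup B_i$) of proper nonempty subsets, and faces of a face are obtained by merging consecutive blocks. A complex is shellable if its facets can be ordered $F_1,\dots,F_m$ so that for each $l\ge2$, $(\bigcup_{i<l}\overline{F_i})\cap\overline{F_l}$ is pure of dimension $\dim F_l-1$, where $\overline{F}$ is the set of faces of $F$. -}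

module Defs where

open import Data.Nat using (ℕ; suc)
open import Data.Fin using (Fin)
open import Data.Fin.Subset using (Subset; ⊥; ⊤; _⊂_; _─_; _∈_; ∣_∣)
  renaming (_⊆_ to _⊆ˢ_)
open import Data.List using (List; []; _∷_; length; _++_)
open import Data.List.Relation.Binary.Sublist.Propositional using ()
  renaming (_⊆_ to _⊑_)
open import Data.List.Relation.Unary.Any using (Any)
open import Data.List.Relation.Unary.All using (All)
open import Data.List.Relation.Unary.Unique.Propositional using (Unique)
open import Data.List.Membership.Propositional using () renaming (_∈_ to _∈ₗ_)
open import Data.Product using (Σ; ∃; _×_)
open import Relation.Binary.PropositionalEquality using (_≡_; _≢_)

Hypergraph : ℕ → Set₁
Hypergraph n = Subset n → Set

-- A chain ∅ ⊊ S₁ ⊊ ... ⊊ S_m ⊊ [n] is represented by the list [S₁, ..., S_m].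
-- IsChainFrom prev Ss : prev ⊊ S₁ ⊊ ... ⊊ S_m ⊊ [n].
IsChainFrom : ∀ {n} → Subset n → List (Subset n) → Set
IsChainFrom prev []       = prev ⊂ ⊤
IsChainFrom prev (S ∷ Ss) = prev ⊂ S × IsChainFrom S Ss

IsChain : ∀ {n} → List (Subset n) → Set
IsChain Ss = IsChainFrom ⊥ Ss

blocksFrom : ∀ {n} → Subset n → List (Subset n) → List (Subset n)
blocksFrom prev []       = (⊤ ─ prev) ∷ []
blocksFrom prev (S ∷ Ss) = (S ─ prev) ∷ blocksFrom S Ss

blocks : ∀ {n} → List (Subset n) → List (Subset n)
blocks Ss = blocksFrom ⊥ Ss

ContainsEdge : ∀ {n} → Hypergraph n → Subset n → Set
ContainsEdge H B = ∃ λ e → H e × e ⊆ˢ B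

-- Faces of the coloring complex Λ(H): chains of proper nonempty subsets
-- (equivalently ordered set partitions) in which some block contains an edge.
-- A chain with m subsets is a face of dimension m - 1 (the empty chain is the
-- empty face, of dimension -1).
Face : ∀ {n} → Hypergraph n → List (Subset n) → Set
Face H Ss = IsChain Ss × Any (ContainsEdge H) (blocks Ss)

-- The faces of a face F (its closure F̄) are exactly the subchains of F
-- (merging consecutive blocks = deleting subsets from the chain).
-- Facets: faces maximal with respect to inclusion.
Facet : ∀ {n} → Hypergraph n → List (Subset n) → Set
Facet H F = Face H F × (∀ G → Face H G → F ⊑ G → G ≡ F)

-- (⋃_{F' ∈ earlier} F̄') ∩ F̄ is pure of dimension dim F - 1: every face G in
-- it lies in a face G' in it with dim G' = dim F - 1, i.e. length G' + 1 = length F.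
ShellStep : ∀ {n} → List (List (Subset n)) → List (Subset n) → Set
ShellStep earlier F =
  ∀ G → G ⊑ F → Any (G ⊑_) earlier →
    ∃ λ G′ → G ⊑ G′ × G′ ⊑ F × Any (G′ ⊑_) earlier × suc (length G′) ≡ length F

IsShelling : ∀ {n} → Hypergraph n → List (List (Subset n)) → Set
IsShelling H L =
  Unique L × All (Facet H) L × (∀ F → Facet H F → F ∈ₗ L) ×
  (∀ pre F post → L ≡ pre ++ (F ∷ post) → pre ≢ [] → ShellStep pre F)

Shellable : ∀ {n} → Hypergraph n → Set
Shellable H = ∃ λ L → IsShelling H L

-- The facets of Λ(H) are the chains whose blocks are singletons {x} with x ≠ v, except for
-- one block which is an edge. List them lexicographically, a subset coming first when it
-- contains the least element on which the two subsets differ. If the facet F′ precedes F, then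
-- some subset r of F is missing from F′, while F with r deleted lies in a facet preceding F;
-- this gives the shelling condition. To find r, look at the first subset c of F that differs
-- from F′. Either c can be replaced by a lexicographically smaller subset, by swapping two
-- adjacent singleton blocks or by trading an element between the edge and an adjacent
-- singleton, or such a swap becomes possible further along the increasing run of singleton
-- blocks that follows c.

module Submission where

open import Defs
open import Level using (Level)
open import Data.Bool using (true; false)
open import Data.Bool.Properties using () renaming (_≟_ to _≟ᵇ_)
open import Data.Nat as ℕ using (ℕ; zero; suc; _+_; _≤_; s≤s)
open import Data.Nat.Properties
  using (+-suc; +-comm; +-cancelʳ-≡; suc-injective; <-irrefl; ≤-trans; ≤-pred; ≤-reflexive; m≤m+n; n≤1+n)
open import Data.Fin as Fin using (Fin; zero; suc)
open import Data.Fin.Properties using (<-cmp; _<?_; any?)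
  renaming (_≟_ to _≟ᶠ_; <-trans to <ᶠ-trans; <-irrefl to <ᶠ-irrefl)
open import Data.Fin.Subset
open import Data.Fin.Subset.Properties
open import Data.Vec using ([]; _∷_; here; there)
open import Data.Vec.Properties using (≡-dec)
open import Data.List using (List; []; _∷_; length; _++_; map; foldr; filter; cartesianProductWith)
open import Data.List.Properties using (length-removeAt′)
open import Data.List.Relation.Unary.Any as Any using (Any; here; there; index)
open import Data.List.Relation.Unary.All as All using (All; []; _∷_)
open import Data.List.Relation.Unary.All.Properties using (All¬⇒¬Any)
open import Data.List.Relation.Unary.AllPairs as AllPairs using (AllPairs; []; _∷_)
open import Data.List.Relation.Binary.Sublist.Propositional
  using ([]; _∷_; _∷ʳ_; minimum)
  renaming (_⊆_ to _⊑_; ⊆-refl to ⊑-refl; ⊆-trans to ⊑-trans; ⊆-antisym to ⊑-antisym)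
import Data.List.Relation.Binary.Sublist.Propositional as Sublist
open import Data.List.Relation.Binary.Sublist.Propositional.Properties using (to-≋; ++⁺ˡ)
open import Data.List.Relation.Binary.Equality.Propositional using (≋⇒≡)
open import Data.List.Relation.Binary.Lex.Core using (Lex-<; base; halt; this; next)
import Data.List.Relation.Binary.Lex.Strict as Lex
open import Data.List.Relation.Binary.Pointwise using (Pointwise-≡⇒≡; ≡⇒Pointwise-≡)
open import Data.List.Membership.Propositional using (find; lose) renaming (_∈_ to _∈ₗ_; _∉_ to _∉ₗ_)
open import Data.List.Membership.Propositional.Properties
  using (∈-++⁺ˡ; ∈-++⁺ʳ; ∈-++⁻; ∈-map⁺; ∈-filter⁺; ∈-filter⁻; ∈-cartesianProductWith⁺)
open import Data.Product using (Σ; ∃; _×_; _,_; proj₁; proj₂; uncurry; map₁; map₂)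
open import Data.Sum using (_⊎_; inj₁; inj₂)
open import Function using (_∘_)
open import Function.Bundles using (_⇔_; mk⇔; Equivalence)
import Function.Properties.Equivalence as ⇔
open import Relation.Nullary using (Dec; yes; no; ¬?; contradiction)
open import Relation.Nullary.Decidable using (_×-dec_; map′)
open import Relation.Binary using (Rel; Transitive; Trichotomous; Tri; tri<; tri≈; tri>)
open import Relation.Binary.Consequences using (tri⇒irr; tri⇒asym)
open import Relation.Binary.PropositionalEquality
  using (_≡_; _≢_; refl; sym; trans; cong; cong₂; subst; isEquivalence; resp₂; module ≡-Reasoning)
open ≡-Reasoning

private variable
  a ℓ : Level
  A : Set a
  n : ℕ
  x : Fin n
  p q : Subset n

─-⊑ : ∀ {P : A → Set ℓ} {xs} (p : Any P xs) → (xs Any.─ p) ⊑ xs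
─-⊑ (here _)  = _ ∷ʳ ⊑-refl
─-⊑ (there p) = refl ∷ ─-⊑ p

⊑-─ : ∀ {x : A} {xs ys} (x∈xs : x ∈ₗ xs) → ys ⊑ xs → x ∉ₗ ys → ys ⊑ (xs Any.─ x∈xs)
⊑-─ (here refl) (_ ∷ʳ τ)   _   = τ
⊑-─ (here refl) (refl ∷ τ) x∉ = contradiction (here refl) x∉
⊑-─ (there p)   (y ∷ʳ τ)   x∉ = y ∷ʳ ⊑-─ p τ x∉
⊑-─ (there p)   (refl ∷ τ) x∉ = refl ∷ ⊑-─ p τ (x∉ ∘ there)

module _ {R : Rel A ℓ} where

  AllPairs-before : ∀ pre {y post x} → AllPairs R (pre ++ y ∷ post) → x ∈ₗ pre → R x y
  AllPairs-before (_ ∷ pre) (r ∷ _)  (here refl) = All.lookup r (∈-++⁺ʳ pre (here refl))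
  AllPairs-before (_ ∷ pre) (_ ∷ rs) (there x∈)  = AllPairs-before pre rs x∈

  AllPairs-after : ∀ pre {y post x} → AllPairs R (pre ++ y ∷ post) → x ∈ₗ post → R y x
  AllPairs-after []        (r ∷ _)  x∈ = All.lookup r x∈
  AllPairs-after (_ ∷ pre) (_ ∷ rs) x∈ = AllPairs-after pre rs x∈

module StrictSort {_<_ : Rel A ℓ} (compare : Trichotomous _≡_ _<_) (<-trans : Transitive _<_) where

  insert : A → List A → List A
  insert x []       = x ∷ []
  insert x (y ∷ ys) with compare x y
  ... | tri< _ _ _ = x ∷ y ∷ ys
  ... | tri≈ _ _ _ = y ∷ ys
  ... | tri> _ _ _ = y ∷ insert x ys

  ∈-insert⁺ : ∀ {z x} ys → z ≡ x ⊎ z ∈ₗ ys → z ∈ₗ insert x ys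
  ∈-insert⁺ []       (inj₁ refl) = here refl
  ∈-insert⁺ {x = x} (y ∷ ys) z∈ with compare x y | z∈
  ... | tri< _ _ _    | inj₁ refl = here refl
  ... | tri< _ _ _    | inj₂ z∈ys = there z∈ys
  ... | tri≈ _ refl _ | inj₁ refl = here refl
  ... | tri≈ _ _ _    | inj₂ z∈ys = z∈ys
  ... | tri> _ _ _    | inj₁ refl = there (∈-insert⁺ ys (inj₁ refl))
  ... | tri> _ _ _    | inj₂ (here refl) = here refl
  ... | tri> _ _ _    | inj₂ (there z∈ys) = there (∈-insert⁺ ys (inj₂ z∈ys))

  ∈-insert⁻ : ∀ {z x} ys → z ∈ₗ insert x ys → z ≡ x ⊎ z ∈ₗ ys
  ∈-insert⁻ []       (here refl) = inj₁ refl
  ∈-insert⁻ {x = x} (y ∷ ys) z∈ with compare x y | z∈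
  ... | tri< _ _ _ | here refl = inj₁ refl
  ... | tri< _ _ _ | there z∈ys = inj₂ z∈ys
  ... | tri≈ _ _ _ | z∈ys = inj₂ z∈ys
  ... | tri> _ _ _ | here refl = inj₂ (here refl)
  ... | tri> _ _ _ | there z∈′ with ∈-insert⁻ ys z∈′
  ...   | inj₁ z≡x  = inj₁ z≡x
  ...   | inj₂ z∈ys = inj₂ (there z∈ys)

  insert-sorted : ∀ {x ys} → AllPairs _<_ ys → AllPairs _<_ (insert x ys)
  insert-sorted {x} {[]} [] = [] ∷ []
  insert-sorted {x} {y ∷ ys} (y<ys ∷ sorted) with compare x y
  ... | tri< x<y _ _ = (x<y ∷ All.map (<-trans x<y) y<ys) ∷ y<ys ∷ sorted
  ... | tri≈ _ _ _   = y<ys ∷ sorted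
  ... | tri> _ _ y<x = All.tabulate below ∷ insert-sorted sorted
    where
    below : ∀ {z} → z ∈ₗ insert x ys → y < z
    below z∈ with ∈-insert⁻ ys z∈
    ... | inj₁ refl = y<x
    ... | inj₂ z∈ys = All.lookup y<ys z∈ys

  strictSort : List A → List A
  strictSort = foldr insert []

  ∈-strictSort : ∀ {z} xs → z ∈ₗ strictSort xs ⇔ z ∈ₗ xs
  ∈-strictSort xs = mk⇔ (to xs) (from xs)
    where
    to : ∀ {z} xs → z ∈ₗ strictSort xs → z ∈ₗ xs
    to (x ∷ xs) z∈ with ∈-insert⁻ (strictSort xs) z∈
    ... | inj₁ refl = here refl
    ... | inj₂ z∈′  = there (to xs z∈′)
    from : ∀ {z} xs → z ∈ₗ xs → z ∈ₗ strictSort xs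
    from (x ∷ xs) (here refl) = ∈-insert⁺ (strictSort xs) (inj₁ refl)
    from (x ∷ xs) (there z∈)  = ∈-insert⁺ (strictSort xs) (inj₂ (from xs z∈))

  strictSort-sorted : ∀ xs → AllPairs _<_ (strictSort xs)
  strictSort-sorted []       = []
  strictSort-sorted (x ∷ xs) = insert-sorted (strictSort-sorted xs)

  sorted⇒before : ∀ pre {y post x} → AllPairs _<_ (pre ++ y ∷ post) →
                  x ∈ₗ pre ++ y ∷ post → x < y → x ∈ₗ pre
  sorted⇒before pre sorted x∈ x<y with ∈-++⁻ pre x∈
  ... | inj₁ x∈pre         = x∈pre
  ... | inj₂ (here refl)   = contradiction x<y (tri⇒irr compare refl)
  ... | inj₂ (there x∈post) = contradiction x<y (tri⇒asym compare (AllPairs-after pre sorted x∈post))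

listsOfLength≤ : List A → ℕ → List (List A)
listsOfLength≤ xs zero    = [] ∷ []
listsOfLength≤ xs (suc m) = [] ∷ cartesianProductWith _∷_ xs (listsOfLength≤ xs m)

∈-listsOfLength≤ : ∀ {xs : List A} m {ys} → All (_∈ₗ xs) ys → length ys ≤ m → ys ∈ₗ listsOfLength≤ xs m
∈-listsOfLength≤ zero    []       _   = here refl
∈-listsOfLength≤ (suc m) []       _   = here refl
∈-listsOfLength≤ (suc m) (y∈ ∷ ys∈) (s≤s len) =
  there (∈-cartesianProductWith⁺ _∷_ y∈ (∈-listsOfLength≤ m ys∈ len))

allSubsets : ∀ m → List (Subset m)
allSubsets zero    = [] ∷ []
allSubsets (suc m) = map (true ∷_) (allSubsets m) ++ map (false ∷_) (allSubsets m)

∈-allSubsets : ∀ {m} (p : Subset m) → p ∈ₗ allSubsets m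
∈-allSubsets []                 = here refl
∈-allSubsets {suc m} (true ∷ p)  = ∈-++⁺ˡ (∈-map⁺ (true ∷_) (∈-allSubsets p))
∈-allSubsets {suc m} (false ∷ p) = ∈-++⁺ʳ (map (true ∷_) (allSubsets m)) (∈-map⁺ (false ∷_) (∈-allSubsets p))

shellStep-byRemoval : ∀ {n} {earlier : List (List (Subset n))} {F} →
  (∀ {F′} → F′ ∈ₗ earlier → ∃ λ r → Σ (r ∈ₗ F) λ r∈F → r ∉ₗ F′ × Any ((F Any.─ r∈F) ⊑_) earlier) →
  ShellStep earlier F
shellStep-byRemoval {F = F} removal G G⊑F G⊑earlier with find G⊑earlier
... | F′ , F′∈ , G⊑F′ with removal F′∈
... | r , r∈F , r∉F′ , earlierSuperset =
  (F Any.─ r∈F) , ⊑-─ r∈F G⊑F (r∉F′ ∘ Sublist.lookup G⊑F′) , ─-⊑ r∈F ,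
  earlierSuperset , sym (length-removeAt′ F (index r∈F))

face-mono : ∀ {H H′ : Hypergraph n} {F} → (∀ e → H e → H′ e) → Face H F → Face H′ F
face-mono H⇒H′ (chain , hasEdge) = chain , Any.map (map₂ (map₁ (H⇒H′ _))) hasEdge

facet-resp : ∀ {H H′ : Hypergraph n} {F} → (∀ e → H e ⇔ H′ e) → Facet H F → Facet H′ F
facet-resp H⇔H′ (face , maximal) =
  face-mono (Equivalence.to ∘ H⇔H′) face , λ G → maximal G ∘ face-mono (Equivalence.from ∘ H⇔H′)

shellable-resp : ∀ {H H′ : Hypergraph n} → (∀ e → H e ⇔ H′ e) → Shellable H → Shellable H′
shellable-resp H⇔H′ (L , unique , facets , complete , steps) =
  L , unique , All.map (facet-resp H⇔H′) facets , (λ F → complete F ∘ facet-resp (⇔.sym ∘ H⇔H′)) , steps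

-- Subsets of Fin n and their lexicographic order

Disjoint : Subset n → Subset n → Set
Disjoint p q = ∀ {x} → x ∈ p → x ∉ q

x∈p⇒⁅x⁆⊆p : x ∈ p → ⁅ x ⁆ ⊆ p
x∈p⇒⁅x⁆⊆p {x = x} x∈p y∈⁅x⁆ with refl ← x∈⁅y⁆⇒x≡y x y∈⁅x⁆ = x∈p

∈singleton : ∀ {B : Subset n} {x} → B ≡ ⁅ x ⁆ → x ∈ B
∈singleton {x = x} refl = x∈⁅x⁆ x

∈singleton⇒≡ : ∀ {B : Subset n} {x y} → B ≡ ⁅ x ⁆ → y ∈ B → y ≡ x
∈singleton⇒≡ {x = x} refl = x∈⁅y⁆⇒x≡y x

∪-⊆ : ∀ {p q r : Subset n} → p ⊆ r → q ⊆ r → p ∪ q ⊆ r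
∪-⊆ {p = p} {q} p⊆r q⊆r x∈p∪q with x∈p∪q⁻ p q x∈p∪q
... | inj₁ x∈p = p⊆r x∈p
... | inj₂ x∈q = q⊆r x∈q

x∈p─q⇒x∉q : ∀ (p q : Subset n) → x ∈ p ─ q → x ∉ q
x∈p─q⇒x∉q (_ ∷ p) (true ∷ q)  (there x∈) (there x∈q) = x∈p─q⇒x∉q p q x∈ x∈q
x∈p─q⇒x∉q (_ ∷ p) (false ∷ q) (there x∈) (there x∈q) = x∈p─q⇒x∉q p q x∈ x∈q

∣q∣≡∣p∣+∣q─p∣ : p ⊆ q → ∣ q ∣ ≡ ∣ p ∣ + ∣ q ─ p ∣
∣q∣≡∣p∣+∣q─p∣ {p = []}        {q = []}         _   = refl
∣q∣≡∣p∣+∣q─p∣ {p = true ∷ p}  {q = true ∷ q}  p⊆q = cong suc (∣q∣≡∣p∣+∣q─p∣ (drop-∷-⊆ p⊆q))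
∣q∣≡∣p∣+∣q─p∣ {p = true ∷ p}  {q = false ∷ q} p⊆q with () ← p⊆q here
∣q∣≡∣p∣+∣q─p∣ {p = false ∷ p} {q = true ∷ q}  p⊆q =
  trans (cong suc (∣q∣≡∣p∣+∣q─p∣ (drop-∷-⊆ p⊆q))) (sym (+-suc ∣ p ∣ ∣ q ─ p ∣))
∣q∣≡∣p∣+∣q─p∣ {p = false ∷ p} {q = false ∷ q} p⊆q = ∣q∣≡∣p∣+∣q─p∣ (drop-∷-⊆ p⊆q)

x∈p⇒∣p∣≡1+∣p-x∣ : x ∈ p → ∣ p ∣ ≡ suc ∣ p - x ∣
x∈p⇒∣p∣≡1+∣p-x∣ {x = x} {p} x∈p =
  trans (∣q∣≡∣p∣+∣q─p∣ (x∈p⇒⁅x⁆⊆p x∈p)) (cong (_+ ∣ p - x ∣) (∣⁅x⁆∣≡1 x))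

∣N─S∣≡∣N─c∣+∣c─S∣ : ∀ {S c N : Subset n} → S ⊆ c → c ⊆ N → ∣ N ─ S ∣ ≡ ∣ N ─ c ∣ + ∣ c ─ S ∣
∣N─S∣≡∣N─c∣+∣c─S∣ {S = []} {[]} {[]} _ _ = refl
∣N─S∣≡∣N─c∣+∣c─S∣ {S = true ∷ S} {false ∷ c} S⊆c _ with () ← S⊆c here
∣N─S∣≡∣N─c∣+∣c─S∣ {c = true ∷ c} {false ∷ N} _ c⊆N with () ← c⊆N here
∣N─S∣≡∣N─c∣+∣c─S∣ {S = true ∷ S} {true ∷ c} {true ∷ N} S⊆c c⊆N =
  ∣N─S∣≡∣N─c∣+∣c─S∣ (drop-∷-⊆ S⊆c) (drop-∷-⊆ c⊆N)
∣N─S∣≡∣N─c∣+∣c─S∣ {S = false ∷ S} {true ∷ c} {true ∷ N} S⊆c c⊆N =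
  trans (cong suc (∣N─S∣≡∣N─c∣+∣c─S∣ (drop-∷-⊆ S⊆c) (drop-∷-⊆ c⊆N))) (sym (+-suc ∣ N ─ c ∣ ∣ c ─ S ∣))
∣N─S∣≡∣N─c∣+∣c─S∣ {S = false ∷ S} {false ∷ c} {true ∷ N} S⊆c c⊆N =
  cong suc (∣N─S∣≡∣N─c∣+∣c─S∣ (drop-∷-⊆ S⊆c) (drop-∷-⊆ c⊆N))
∣N─S∣≡∣N─c∣+∣c─S∣ {S = false ∷ S} {false ∷ c} {false ∷ N} S⊆c c⊆N =
  ∣N─S∣≡∣N─c∣+∣c─S∣ (drop-∷-⊆ S⊆c) (drop-∷-⊆ c⊆N)

p∪q─p≡q : ∀ {n} {p q : Subset n} → Disjoint q p → p ∪ q ─ p ≡ q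
p∪q─p≡q {p = []}        {q = []}        _ = refl
p∪q─p≡q {p = true ∷ p}  {q = true ∷ q}  q∩p=∅ = contradiction here (q∩p=∅ here)
p∪q─p≡q {p = true ∷ p}  {q = false ∷ q} q∩p=∅ = cong (false ∷_) (p∪q─p≡q (λ x∈q x∈p → q∩p=∅ (there x∈q) (there x∈p)))
p∪q─p≡q {p = false ∷ p} {q = b ∷ q}     q∩p=∅ = cong (b ∷_) (p∪q─p≡q (λ x∈q x∈p → q∩p=∅ (there x∈q) (there x∈p)))

p⊆q⇒q─[q─p]≡p : p ⊆ q → q ─ (q ─ p) ≡ p
p⊆q⇒q─[q─p]≡p {p = []}        {q = []}        _ = refl
p⊆q⇒q─[q─p]≡p {p = true ∷ p}  {q = false ∷ q} p⊆q with () ← p⊆q here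
p⊆q⇒q─[q─p]≡p {p = true ∷ p}  {q = true ∷ q}  p⊆q = cong (true ∷_) (p⊆q⇒q─[q─p]≡p (drop-∷-⊆ p⊆q))
p⊆q⇒q─[q─p]≡p {p = false ∷ p} {q = true ∷ q}  p⊆q = cong (false ∷_) (p⊆q⇒q─[q─p]≡p (drop-∷-⊆ p⊆q))
p⊆q⇒q─[q─p]≡p {p = false ∷ p} {q = false ∷ q} p⊆q = cong (false ∷_) (p⊆q⇒q─[q─p]≡p (drop-∷-⊆ p⊆q))

N─[c─S]─S≡N─c : ∀ {S c N : Subset n} → S ⊆ c → c ⊆ N → N ─ (c ─ S) ─ S ≡ N ─ c
N─[c─S]─S≡N─c {S = []} {[]} {[]} _ _ = refl
N─[c─S]─S≡N─c {S = true ∷ S} {false ∷ c} S⊆c _ with () ← S⊆c here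
N─[c─S]─S≡N─c {c = true ∷ c} {false ∷ N} _ c⊆N with () ← c⊆N here
N─[c─S]─S≡N─c {S = true ∷ S} {true ∷ c} {true ∷ N} S⊆c c⊆N =
  cong (false ∷_) (N─[c─S]─S≡N─c (drop-∷-⊆ S⊆c) (drop-∷-⊆ c⊆N))
N─[c─S]─S≡N─c {S = false ∷ S} {true ∷ c} {true ∷ N} S⊆c c⊆N =
  cong (false ∷_) (N─[c─S]─S≡N─c (drop-∷-⊆ S⊆c) (drop-∷-⊆ c⊆N))
N─[c─S]─S≡N─c {S = false ∷ S} {false ∷ c} {b ∷ N} S⊆c c⊆N =
  cong (b ∷_) (N─[c─S]─S≡N─c (drop-∷-⊆ S⊆c) (drop-∷-⊆ c⊆N))

q⊆p∧Empty[p─q]⇒p≡q : ∀ {n} {p q : Subset n} → q ⊆ p → Empty (p ─ q) → p ≡ q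
q⊆p∧Empty[p─q]⇒p≡q {p = []}        {[]}        _ _ = refl
q⊆p∧Empty[p─q]⇒p≡q {p = true ∷ p}  {false ∷ q} _ p─q=∅ = contradiction (zero , here) p─q=∅
q⊆p∧Empty[p─q]⇒p≡q {p = false ∷ p} {true ∷ q}  q⊆p _ with () ← q⊆p here
q⊆p∧Empty[p─q]⇒p≡q {p = true ∷ p}  {true ∷ q}  q⊆p p─q=∅ =
  cong (true ∷_) (q⊆p∧Empty[p─q]⇒p≡q (drop-∷-⊆ q⊆p) λ (x , x∈) → p─q=∅ (suc x , there x∈))
q⊆p∧Empty[p─q]⇒p≡q {p = false ∷ p} {false ∷ q} q⊆p p─q=∅ =
  cong (false ∷_) (q⊆p∧Empty[p─q]⇒p≡q (drop-∷-⊆ q⊆p) λ (x , x∈) → p─q=∅ (suc x , there x∈))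

N-y≡c : ∀ {c N : Subset n} {y} → c ⊆ N → N ─ c ≡ ⁅ y ⁆ → N - y ≡ c
N-y≡c {c = c} {N} c⊆N N─c≡⁅y⁆ = subst (λ B → N ─ B ≡ c) N─c≡⁅y⁆ (p⊆q⇒q─[q─p]≡p c⊆N)

c─S⊆N─S : ∀ {S c N : Subset n} → c ⊆ N → c ─ S ⊆ N ─ S
c─S⊆N─S {S = S} {c} c⊆N x∈c─S = x∈p∧x∉q⇒x∈p─q (c⊆N (p─q⊆p c S x∈c─S)) (x∈p─q⇒x∉q c S x∈c─S)

N─c⊆N─S : ∀ {S c N : Subset n} → S ⊆ c → N ─ c ⊆ N ─ S
N─c⊆N─S {S = S} {c} {N} S⊆c x∈N─c = x∈p∧x∉q⇒x∈p─q (p─q⊆p N c x∈N─c) (x∈p─q⇒x∉q N c x∈N─c ∘ S⊆c)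

p⊂q⇒Nonempty[q─p] : p ⊂ q → Nonempty (q ─ p)
p⊂q⇒Nonempty[q─p] (_ , x , x∈q , x∉p) = x , x∈p∧x∉q⇒x∈p─q x∈q x∉p

infix 4 _⊏_

data _⊏_ : Subset n → Subset n → Set where
  this : ∀ {p q : Subset n} → true ∷ p ⊏ false ∷ q
  next : ∀ {p q : Subset n} {b} → p ⊏ q → b ∷ p ⊏ b ∷ q

⊏-trans : Transitive {A = Subset n} _⊏_
⊏-trans this        (next _)    = this
⊏-trans (next _)    this        = this
⊏-trans (next p⊏q) (next q⊏r) = next (⊏-trans p⊏q q⊏r)

∷-tri : ∀ {b} → Tri (p ⊏ q) (p ≡ q) (q ⊏ p) → Tri (b ∷ p ⊏ b ∷ q) (b ∷ p ≡ b ∷ q) (b ∷ q ⊏ b ∷ p)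
∷-tri (tri< p⊏q p≢q q⊐p) = tri< (next p⊏q) (λ { refl → p≢q refl }) (λ { (next q⊏p) → q⊐p q⊏p })
∷-tri (tri≈ p⊐q refl _)  = tri≈ (λ { (next p⊏p) → p⊐q p⊏p }) refl (λ { (next p⊏p) → p⊐q p⊏p })
∷-tri (tri> p⊐q p≢q q⊏p) = tri> (λ { (next p⊏q) → p⊐q p⊏q }) (λ { refl → p≢q refl }) (next q⊏p)

⊏-cmp : Trichotomous {A = Subset n} _≡_ _⊏_
⊏-cmp []          []          = tri≈ (λ ()) refl (λ ())
⊏-cmp (true ∷ p)  (false ∷ q) = tri< this (λ ()) (λ ())
⊏-cmp (false ∷ p) (true ∷ q)  = tri> (λ ()) (λ ()) this
⊏-cmp (true ∷ p)  (true ∷ q)  = ∷-tri (⊏-cmp p q)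
⊏-cmp (false ∷ p) (false ∷ q) = ∷-tri (⊏-cmp p q)

FirstDifference : Subset n → Subset n → Fin n → Set
FirstDifference p q i = i ∈ p × i ∉ q × (∀ {j} → j Fin.< i → j ∈ q → j ∈ p)

⊏⇒firstDifference : p ⊏ q → ∃ (FirstDifference p q)
⊏⇒firstDifference this = zero , here , (λ ()) , λ ()
⊏⇒firstDifference (next p⊏q) with i , i∈p , i∉q , agree ← ⊏⇒firstDifference p⊏q =
  suc i , there i∈p , (λ { (there i∈q) → i∉q i∈q }) , below
  where
  below : ∀ {j} → j Fin.< suc i → j ∈ _ ∷ _ → j ∈ _ ∷ _
  below {zero}  _         here        = here
  below {suc j} (s≤s j<i) (there j∈q) = there (agree j<i j∈q)

firstDifference-minimal : ∀ {i j} → FirstDifference p q i → j ∈ q → j ∉ p → i Fin.< j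
firstDifference-minimal {i = i} {j} (_ , i∉q , agree) j∈q j∉p with <-cmp i j
... | tri< i<j _ _  = i<j
... | tri≈ _ refl _ = contradiction j∈q i∉q
... | tri> _ _ j<i  = contradiction (agree j<i j∈q) j∉p

⊂⇒⊐ : p ⊂ q → q ⊏ p
⊂⇒⊐ {p = true ∷ p}  {q = false ∷ q} (p⊆q , _) with () ← p⊆q here
⊂⇒⊐ {p = false ∷ p} {q = true ∷ q}  _ = this
⊂⇒⊐ {p = true ∷ p}  {q = true ∷ q}  (p⊆q , zero , _ , x∉p) = contradiction here x∉p
⊂⇒⊐ {p = true ∷ p}  {q = true ∷ q}  (p⊆q , suc x , there x∈q , x∉p) =
  next (⊂⇒⊐ (drop-∷-⊆ p⊆q , x , x∈q , x∉p ∘ there))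
⊂⇒⊐ {p = false ∷ p} {q = false ∷ q} (p⊆q , suc x , there x∈q , x∉p) =
  next (⊂⇒⊐ (drop-∷-⊆ p⊆q , x , x∈q , x∉p ∘ there))

p-x⊏p-y : ∀ {x y : Fin n} → y Fin.< x → x ∈ p → y ∈ p → p - x ⊏ p - y
p-x⊏p-y {x = suc x} {zero}  _         _           here        = this
p-x⊏p-y {x = suc x} {suc y} (s≤s y<x) (there x∈p) (there y∈p) = next (p-x⊏p-y y<x x∈p y∈p)

infix 4 _<ₗ_
_<ₗ_ : List (Subset n) → List (Subset n) → Set
_<ₗ_ = Lex-< _≡_ _⊏_

<ₗ-cmp : Trichotomous {A = List (Subset n)} _≡_ _<ₗ_
<ₗ-cmp xs ys with Lex.<-compare sym ⊏-cmp xs ys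
... | tri< xs<ys xs≢ys xs≯ys = tri< xs<ys (xs≢ys ∘ ≡⇒Pointwise-≡) xs≯ys
... | tri≈ xs≮ys xs≡ys xs≯ys = tri≈ xs≮ys (Pointwise-≡⇒≡ xs≡ys) xs≯ys
... | tri> xs≮ys xs≢ys xs>ys = tri> xs≮ys (xs≢ys ∘ ≡⇒Pointwise-≡) xs>ys

<ₗ-trans : Transitive {A = List (Subset n)} _<ₗ_
<ₗ-trans = Lex.<-transitive isEquivalence (resp₂ _⊏_) ⊏-trans

-- Facets of the coloring complex of a star

module StarFacets {n : ℕ} (k : ℕ) (v : Fin n) where

  Star : Hypergraph n
  Star e = ∣ e ∣ ≡ k × v ∈ e

  -- A facet of Λ(Star) is a chain ⊥ ⊂ F₁ ⊂ ⋯ ⊂ ⊤ whose blocks are all FacetBlocks, exactly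
  -- one of them an edge; FacetPath S T F is the segment of such a chain running from S to T.
  data FacetBlock (B : Subset n) : Set where
    singleton : ∀ {x} → x ≢ v → B ≡ ⁅ x ⁆ → FacetBlock B
    edge      : Star B → FacetBlock B

  FacetStep : Subset n → Subset n → Set
  FacetStep S c = S ⊆ c × FacetBlock (c ─ S)

  data FacetPath : Subset n → Subset n → List (Subset n) → Set where
    [_] : ∀ {S T} → FacetStep S T → FacetPath S T []
    _∷_ : ∀ {S c T F} → FacetStep S c → FacetPath c T F → FacetPath S T (c ∷ F)

  infixr 5 _++ᶠ_
  _++ᶠ_ : ∀ {S g T P F} → FacetPath S g P → FacetPath g T F → FacetPath S T (P ++ g ∷ F)
  [ step ]      ++ᶠ path′ = step ∷ path′
  (step ∷ path) ++ᶠ path′ = step ∷ (path ++ᶠ path′)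

  headOr : Subset n → List (Subset n) → Subset n
  headOr T []      = T
  headOr T (c ∷ _) = c

  firstStep : ∀ {S T F} → FacetPath S T F → FacetStep S (headOr T F)
  firstStep [ step ]   = step
  firstStep (step ∷ _) = step

  replaceFirst : ∀ {S S′ T F} → FacetPath S T F → FacetStep S′ (headOr T F) → FacetPath S′ T F
  replaceFirst [ _ ]      step = [ step ]
  replaceFirst (_ ∷ path) step = step ∷ path

  v∈block⇒edge : ∀ {B} → FacetBlock B → v ∈ B → Star B
  v∈block⇒edge (singleton x≢v B≡⁅x⁆) v∈B = contradiction (sym (∈singleton⇒≡ B≡⁅x⁆ v∈B)) x≢v
  v∈block⇒edge (edge star)          _   = star

  facetBlock-nonempty : ∀ {B} → FacetBlock B → Nonempty B
  facetBlock-nonempty (singleton {x} _ refl) = x , x∈⁅x⁆ x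
  facetBlock-nonempty (edge (_ , v∈B))       = v , v∈B

  facetStep⇒⊂ : ∀ {S c} → FacetStep S c → S ⊂ c
  facetStep⇒⊂ {S} {c} (S⊆c , block) with facetBlock-nonempty block
  ... | x , x∈c─S = S⊆c , x , p─q⊆p c S x∈c─S , x∈p─q⇒x∉q c S x∈c─S

  facetPath⇒chain : ∀ {S F} → FacetPath S ⊤ F → IsChainFrom S F
  facetPath⇒chain [ step ]      = facetStep⇒⊂ step
  facetPath⇒chain (step ∷ path) = facetStep⇒⊂ step , facetPath⇒chain path

  ∈-facetPath⇒⊃ : ∀ {S T F r} → FacetPath S T F → r ∈ₗ F → S ⊂ r
  ∈-facetPath⇒⊃ (step ∷ _)    (here refl) = facetStep⇒⊂ step
  ∈-facetPath⇒⊃ (step ∷ path) (there r∈F) = ⊂-trans (facetStep⇒⊂ step) (∈-facetPath⇒⊃ path r∈F)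

  edgeStep-size : ∀ {S c : Subset n} → S ⊆ c → Star (c ─ S) → ∣ c ∣ ≡ ∣ S ∣ + k
  edgeStep-size {S} {c} S⊆c (size , _) = trans (∣q∣≡∣p∣+∣q─p∣ {p = S} S⊆c) (cong (∣ S ∣ +_) size)

  singletonStep-size : ∀ {S c : Subset n} {x} → S ⊆ c → c ─ S ≡ ⁅ x ⁆ → ∣ c ∣ ≡ suc ∣ S ∣
  singletonStep-size {S} {c} {x} S⊆c c─S≡⁅x⁆ = begin
    ∣ c ∣             ≡⟨ ∣q∣≡∣p∣+∣q─p∣ {p = S} S⊆c ⟩
    ∣ S ∣ + ∣ c ─ S ∣ ≡⟨ cong (λ B → ∣ S ∣ + ∣ B ∣) c─S≡⁅x⁆ ⟩
    ∣ S ∣ + ∣ ⁅ x ⁆ ∣ ≡⟨ cong (∣ S ∣ +_) (∣⁅x⁆∣≡1 x) ⟩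
    ∣ S ∣ + 1         ≡⟨ +-comm ∣ S ∣ 1 ⟩
    suc ∣ S ∣         ∎

  facetStep-size-∌v : ∀ {S c} → FacetStep S c → v ∉ c ─ S → ∣ c ∣ ≡ suc ∣ S ∣
  facetStep-size-∌v (S⊆c , singleton _ c─S≡⁅x⁆) _    = singletonStep-size S⊆c c─S≡⁅x⁆
  facetStep-size-∌v (_   , edge (_ , v∈c─S))    v∉c─S = contradiction v∈c─S v∉c─S

  length-facetPath-∋v : ∀ {S T F} → FacetPath S T F → v ∈ S → suc (length F) + ∣ S ∣ ≡ ∣ T ∣
  length-facetPath-∋v {S} {T} [ step ] v∈S =
    sym (facetStep-size-∌v step λ v∈T─S → x∈p─q⇒x∉q T S v∈T─S v∈S)
  length-facetPath-∋v {S} {T} {c ∷ F} (step@(S⊆c , _) ∷ path) v∈S = begin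
    suc (suc (length F)) + ∣ S ∣ ≡⟨ +-suc (suc (length F)) ∣ S ∣ ⟨
    suc (length F) + suc ∣ S ∣   ≡⟨ cong (suc (length F) +_) size ⟨
    suc (length F) + ∣ c ∣       ≡⟨ length-facetPath-∋v path (S⊆c v∈S) ⟩
    ∣ T ∣                        ∎
    where
    size = facetStep-size-∌v step λ v∈c─S → x∈p─q⇒x∉q c S v∈c─S v∈S

  length-facetPath-∌v : ∀ {S T F} → FacetPath S T F → v ∉ S → v ∈ T → length F + (k + ∣ S ∣) ≡ ∣ T ∣
  length-facetPath-∌v {S} {T} [ S⊆T , singleton x≢v T─S≡⁅x⁆ ] v∉S v∈T =
    contradiction (sym (∈singleton⇒≡ T─S≡⁅x⁆ (x∈p∧x∉q⇒x∈p─q v∈T v∉S))) x≢v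
  length-facetPath-∌v {S} [ S⊆T , edge star ] _ _ = trans (+-comm k ∣ S ∣) (sym (edgeStep-size S⊆T star))
  length-facetPath-∌v {S} {T} {c ∷ F} (step@(S⊆c , block) ∷ path) v∉S v∈T with v ∈? c
  ... | yes v∈c = begin
    suc (length F) + (k + ∣ S ∣) ≡⟨ cong (suc (length F) +_) (+-comm k ∣ S ∣) ⟩
    suc (length F) + (∣ S ∣ + k) ≡⟨ cong (suc (length F) +_) (edgeStep-size S⊆c star) ⟨
    suc (length F) + ∣ c ∣       ≡⟨ length-facetPath-∋v path v∈c ⟩
    ∣ T ∣                        ∎
    where star = v∈block⇒edge block (x∈p∧x∉q⇒x∈p─q v∈c v∉S)
  ... | no v∉c = begin
    suc (length F) + (k + ∣ S ∣) ≡⟨ +-suc (length F) (k + ∣ S ∣) ⟨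
    length F + suc (k + ∣ S ∣)   ≡⟨ cong (length F +_) (+-suc k ∣ S ∣) ⟨
    length F + (k + suc ∣ S ∣)   ≡⟨ cong (λ m → length F + (k + m)) (facetStep-size-∌v step (v∉c ∘ p─q⊆p c S)) ⟨
    length F + (k + ∣ c ∣)       ≡⟨ length-facetPath-∌v path v∉c v∈T ⟩
    ∣ T ∣                        ∎

  facetPaths-sameLength : ∀ {S T F F′} → FacetPath S T F → FacetPath S T F′ → v ∈ T → length F ≡ length F′
  facetPaths-sameLength {S} path path′ v∈T with v ∈? S
  ... | yes v∈S = suc-injective (+-cancelʳ-≡ ∣ S ∣ _ _
                    (trans (length-facetPath-∋v path v∈S) (sym (length-facetPath-∋v path′ v∈S))))
  ... | no v∉S  = +-cancelʳ-≡ (k + ∣ S ∣) _ _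
                    (trans (length-facetPath-∌v path v∉S v∈T) (sym (length-facetPath-∌v path′ v∉S v∈T)))

  edge⇒v∈ : ∀ {B} → ContainsEdge Star B → v ∈ B
  edge⇒v∈ (_ , (_ , v∈e) , e⊆B) = e⊆B v∈e

  facetPath⇒edgeBlock : ∀ {S F} → FacetPath S ⊤ F → v ∉ S → Any (ContainsEdge Star) (blocksFrom S F)
  facetPath⇒edgeBlock [ _ , block ] v∉S =
    here (_ , v∈block⇒edge block (x∈p∧x∉q⇒x∈p─q ∈⊤ v∉S) , ⊆-refl)
  facetPath⇒edgeBlock {F = c ∷ _} ((_ , block) ∷ path) v∉S with v ∈? c
  ... | yes v∈c = here (_ , v∈block⇒edge block (x∈p∧x∉q⇒x∈p─q v∈c v∉S) , ⊆-refl)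
  ... | no v∉c  = there (facetPath⇒edgeBlock path v∉c)

  facetPath⇒face : ∀ {F} → FacetPath ⊥ ⊤ F → Face Star F
  facetPath⇒face path = facetPath⇒chain path , facetPath⇒edgeBlock path ∉⊥

  Refinable : Subset n → Set
  Refinable B = Nonempty B × (v ∈ B → ContainsEdge Star B)

  stopOrPeel : ∀ {B} → Refinable B → FacetBlock B ⊎ ∃ λ y → y ∈ B × y ≢ v × Refinable (B - y)
  stopOrPeel {B} ((x , x∈B) , hasEdge) with v ∈? B
  ... | no v∉B with nonempty? (B - x)
  ...   | no B-x=∅  = inj₁ (singleton x≢v (q⊆p∧Empty[p─q]⇒p≡q (x∈p⇒⁅x⁆⊆p x∈B) B-x=∅))
    where
    x≢v : x ≢ v
    x≢v refl = v∉B x∈B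
  ...   | yes B-x≢∅ = inj₂ (x , x∈B , (λ { refl → v∉B x∈B }) , B-x≢∅ , λ v∈B-x → contradiction (p─q⊆p B _ v∈B-x) v∉B)
  stopOrPeel {B} (_ , hasEdge) | yes v∈B with hasEdge v∈B
  ... | e , star@(_ , v∈e) , e⊆B with nonempty? (B ─ e)
  ...   | no B─e=∅ = inj₁ (edge (subst Star (sym (q⊆p∧Empty[p─q]⇒p≡q e⊆B B─e=∅)) star))
  ...   | yes (y , y∈B─e) = inj₂ (y , p─q⊆p B e y∈B─e , y≢v , (v , e⊆B-y v∈e) , λ _ → e , star , e⊆B-y)
    where
    y∉e : y ∉ e
    y∉e = x∈p─q⇒x∉q B e y∈B─e
    y≢v : y ≢ v
    y≢v refl = y∉e v∈e
    e⊆B-y : e ⊆ B - y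
    e⊆B-y z∈e = x∈p∧x≢y⇒x∈p-y (e⊆B z∈e) λ { refl → y∉e z∈e }

  singletonStep : ∀ {S y} → y ∉ S → y ≢ v → FacetStep S (S ∪ ⁅ y ⁆)
  singletonStep {S} {y} y∉S y≢v = p⊆p∪q ⁅ y ⁆ , singleton y≢v (p∪q─p≡q ⁅y⁆∩S=∅)
    where
    ⁅y⁆∩S=∅ : Disjoint ⁅ y ⁆ S
    ⁅y⁆∩S=∅ z∈⁅y⁆ with refl ← x∈⁅y⁆⇒x≡y y z∈⁅y⁆ = y∉S

  refine : ∀ m {S g} → ∣ g ─ S ∣ ≤ m → S ⊆ g → Refinable (g ─ S) → ∃ (FacetPath S g)
  refine zero    size _ ((x , x∈g─S) , _) with () ← subst (_≤ 0) (x∈p⇒∣p∣≡1+∣p-x∣ x∈g─S) size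
  refine (suc m) {S} {g} size S⊆g refinable with stopOrPeel refinable
  ... | inj₁ block = [] , [ S⊆g , block ]
  ... | inj₂ (y , y∈g─S , y≢v , refinable′) with refine m size′ (∪-⊆ S⊆g (x∈p⇒⁅x⁆⊆p (p─q⊆p g S y∈g─S))) (subst Refinable g─S─y≡g─[S∪y] refinable′)
    where
    g─S─y≡g─[S∪y] : g ─ S - y ≡ g ─ (S ∪ ⁅ y ⁆)
    g─S─y≡g─[S∪y] = p─q─r≡p─q∪r g S ⁅ y ⁆
    size′ : ∣ g ─ (S ∪ ⁅ y ⁆) ∣ ≤ m
    size′ = ≤-pred (≤-trans (subst (λ B → suc ∣ B ∣ ≤ _) g─S─y≡g─[S∪y] (x∈p⇒∣p-x∣<∣p∣ y∈g─S)) size)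
  ... | P , path = S ∪ ⁅ y ⁆ ∷ P , singletonStep (x∈p─q⇒x∉q g S y∈g─S) y≢v ∷ path

  blocks-avoid : ∀ {g : Subset n} {G x} → IsChainFrom g G → x ∈ g → All (x ∉_) (blocksFrom g G)
  blocks-avoid {g} {[]}    _            x∈g = (λ x∈ → x∈p─q⇒x∉q ⊤ g x∈ x∈g) ∷ []
  blocks-avoid {g} {c ∷ _} (g⊂c , chain) x∈g = (λ x∈ → x∈p─q⇒x∉q c g x∈ x∈g) ∷ blocks-avoid chain (proj₁ g⊂c x∈g)

  firstBlock-refinable : ∀ {S G} → IsChainFrom S G → (v ∉ S → Any (ContainsEdge Star) (blocksFrom S G)) →
                         Refinable (headOr ⊤ G ─ S)
  firstBlock-refinable {S} {[]} S⊂⊤ hasEdge =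
    p⊂q⇒Nonempty[q─p] S⊂⊤ , λ v∈⊤─S → only (hasEdge (x∈p─q⇒x∉q ⊤ S v∈⊤─S))
    where
    only : ∀ {P : Subset n → Set} {B} → Any P (B ∷ []) → P B
    only (here p) = p
  firstBlock-refinable {S} {g ∷ G} (S⊂g , chain) hasEdge = p⊂q⇒Nonempty[q─p] S⊂g , edgeInFirst
    where
    edgeInFirst : v ∈ g ─ S → ContainsEdge Star (g ─ S)
    edgeInFirst v∈g─S with hasEdge (x∈p─q⇒x∉q g S v∈g─S)
    ... | here inFirst  = inFirst
    ... | there inLater = contradiction inLater
      (All¬⇒¬Any (All.map (λ v∉B → v∉B ∘ edge⇒v∈) (blocks-avoid chain (p─q⊆p g S v∈g─S))))

  laterBlocks-edge : ∀ {S g G} → S ⊂ g → (v ∉ S → Any (ContainsEdge Star) (blocksFrom S (g ∷ G))) →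
                     v ∉ g → Any (ContainsEdge Star) (blocksFrom g G)
  laterBlocks-edge {S} {g} S⊂g hasEdge v∉g with hasEdge (v∉g ∘ proj₁ S⊂g)
  ... | here inFirst  = contradiction (p─q⊆p g S (edge⇒v∈ inFirst)) v∉g
  ... | there inLater = inLater

  extend : ∀ {S G} → IsChainFrom S G → (v ∉ S → Any (ContainsEdge Star) (blocksFrom S G)) →
           ∃ λ F → FacetPath S ⊤ F × G ⊑ F
  extend {S} {[]} S⊂⊤ hasEdge
    with P , path ← refine n (∣p∣≤n (⊤ ─ S)) (proj₁ S⊂⊤) (firstBlock-refinable {G = []} S⊂⊤ hasEdge) =
    P , path , minimum P
  extend {S} {g ∷ G} (S⊂g , chain) hasEdge
    with P , path ← refine n (∣p∣≤n (g ─ S)) (proj₁ S⊂g) (firstBlock-refinable {G = g ∷ G} (S⊂g , chain) hasEdge)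
       | F , pathF , G⊑F ← extend chain (laterBlocks-edge S⊂g hasEdge) =
    P ++ g ∷ F , path ++ᶠ pathF , ++⁺ˡ P (refl ∷ G⊑F)

  facetPath⇒facet : ∀ {F} → FacetPath ⊥ ⊤ F → Facet Star F
  facetPath⇒facet {F} path = facetPath⇒face path , maximal
    where
    maximal : ∀ G → Face Star G → F ⊑ G → G ≡ F
    maximal G (chain , hasEdge) F⊑G with F′ , path′ , G⊑F′ ← extend chain (λ _ → hasEdge)
      with refl ← ≋⇒≡ (to-≋ (facetPaths-sameLength path path′ ∈⊤) (⊑-trans F⊑G G⊑F′)) = ⊑-antisym G⊑F′ F⊑G

  facet⇒facetPath : ∀ {F} → Facet Star F → FacetPath ⊥ ⊤ F
  facet⇒facetPath ((chain , hasEdge) , maximal) with F′ , path′ , F⊑F′ ← extend chain (λ _ → hasEdge) =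
    subst (FacetPath ⊥ ⊤) (maximal F′ (facetPath⇒face path′) F⊑F′) path′

-- The exchange lemma

module Exchange {n : ℕ} (k : ℕ) (v : Fin n) (2≤k : 2 ≤ k) where

  open StarFacets k v

  record Removable (S : Subset n) (F : List (Subset n)) (r : Subset n) : Set where
    field
      position              : r ∈ₗ F
      {replacement}         : List (Subset n)
      replacement-facetPath : FacetPath S ⊤ replacement
      replacement-earlier   : replacement <ₗ F
      removal-⊑             : (F Any.─ position) ⊑ replacement

  Replacement : Subset n → Subset n → Subset n → Set
  Replacement S c N = ∃ λ c″ → c″ ⊏ c × FacetStep S c″ × FacetStep c″ N

  removable-head : ∀ {S c rest} → FacetPath c ⊤ rest → Replacement S c (headOr ⊤ rest) → Removable S (c ∷ rest) c
  removable-head path (c″ , c″⊏c , step , step′) = record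
    { position              = here refl
    ; replacement-facetPath = step ∷ replaceFirst path step′
    ; replacement-earlier   = this c″⊏c
    ; removal-⊑             = c″ ∷ʳ ⊑-refl
    }

  removable-∷ : ∀ {S c rest r} → FacetStep S c → Removable c rest r → Removable S (c ∷ rest) r
  removable-∷ step removable = record
    { position              = there position
    ; replacement-facetPath = step ∷ replacement-facetPath
    ; replacement-earlier   = next refl replacement-earlier
    ; removal-⊑             = refl ∷ removal-⊑
    }
    where open Removable removable

  another : ∀ {B} → Star B → ∃ λ z → z ∈ B × z ≢ v
  another {B} (size , v∈B) with nonempty? (B - v)
  ... | yes (z , z∈B-v) = z , p─q⊆p B ⁅ v ⁆ z∈B-v , λ { refl → x∈p─q⇒x∉q B ⁅ v ⁆ z∈B-v (x∈⁅x⁆ v) }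
  ... | no B-v=∅ = contradiction (subst (2 ≤_) k≡1 2≤k) λ { (s≤s ()) }
    where
    k≡1 : k ≡ 1
    k≡1 = begin
      k               ≡⟨ size ⟨
      ∣ B ∣           ≡⟨ x∈p⇒∣p∣≡1+∣p-x∣ v∈B ⟩
      suc ∣ B - v ∣   ≡⟨ cong (suc ∘ ∣_∣) (Empty-unique B-v=∅) ⟩
      suc ∣ ⊥ {n} ∣   ≡⟨ cong suc (∣⊥∣≡0 n) ⟩
      1               ∎

  splitOff : ∀ {S N z} → S ⊆ N → z ∈ N → z ∉ S → z ≢ v → FacetBlock (N - z ─ S) →
             FacetStep S (N - z) × FacetStep (N - z) N
  splitOff {S} {N} {z} S⊆N z∈N z∉S z≢v block =
    (S⊆N-z , block) , (p─q⊆p N ⁅ z ⁆ , singleton z≢v (p⊆q⇒q─[q─p]≡p (x∈p⇒⁅x⁆⊆p z∈N)))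
    where
    S⊆N-z : S ⊆ N - z
    S⊆N-z x∈S = x∈p∧x≢y⇒x∈p-y (S⊆N x∈S) λ { refl → z∉S x∈S }

  shrinkEdge : ∀ {S N z} → ∣ N ─ S ∣ ≡ suc k → v ∈ N ─ S → z ∈ N ─ S → z ≢ v → Star (N - z ─ S)
  shrinkEdge {S} {N} {z} size v∈ z∈ z≢v = subst Star (sym (p─q─r≡p─r─q N ⁅ z ⁆ S))
    (suc-injective (trans (sym (x∈p⇒∣p∣≡1+∣p-x∣ z∈)) size) , x∈p∧x≢y⇒x∈p-y v∈ (z≢v ∘ sym))

  swapSingletons : ∀ {S c N a b} → S ⊆ c → c ─ S ≡ ⁅ a ⁆ → c ⊆ N → N ─ c ≡ ⁅ b ⁆ →
                   a ≢ v → b ≢ v → b Fin.< a → Replacement S c N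
  swapSingletons {S} {c} {N} {a} {b} S⊆c c─S≡⁅a⁆ c⊆N N─c≡⁅b⁆ a≢v b≢v b<a =
    N - a , subst (N - a ⊏_) (N-y≡c c⊆N N─c≡⁅b⁆) (p-x⊏p-y b<a (c⊆N a∈c) b∈N) ,
    splitOff (⊆-trans S⊆c c⊆N) (c⊆N a∈c) a∉S a≢v (singleton b≢v N-a─S≡⁅b⁆)
    where
    a∈c─S = ∈singleton c─S≡⁅a⁆
    a∈c = p─q⊆p c S a∈c─S
    a∉S = x∈p─q⇒x∉q c S a∈c─S
    b∈N = p─q⊆p N c (∈singleton N─c≡⁅b⁆)
    N-a─S≡⁅b⁆ : N - a ─ S ≡ ⁅ b ⁆
    N-a─S≡⁅b⁆ = trans (subst (λ B → N ─ B ─ S ≡ N ─ c) c─S≡⁅a⁆ (N─[c─S]─S≡N─c S⊆c c⊆N)) N─c≡⁅b⁆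

  singletonThenEdge : ∀ {S c N a} → S ⊆ c → c ─ S ≡ ⁅ a ⁆ → c ⊆ N → Star (N ─ c) → Replacement S c N
  singletonThenEdge {S} {c} {N} {a} S⊆c c─S≡⁅a⁆ c⊆N star@(sizeK , v∈N─c)
    with z , z∈N─c , z≢v ← another star =
    N - z , ⊂⇒⊐ c⊂N-z ,
    splitOff (⊆-trans S⊆c c⊆N) (p─q⊆p N c z∈N─c) (x∈p─q⇒x∉q N S z∈N─S) z≢v
      (edge (shrinkEdge size (N─c⊆N─S S⊆c v∈N─c) z∈N─S z≢v))
    where
    z∈N─S = N─c⊆N─S S⊆c z∈N─c
    size : ∣ N ─ S ∣ ≡ suc k
    size = begin
      ∣ N ─ S ∣             ≡⟨ ∣N─S∣≡∣N─c∣+∣c─S∣ S⊆c c⊆N ⟩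
      ∣ N ─ c ∣ + ∣ c ─ S ∣ ≡⟨ cong₂ _+_ sizeK (trans (cong ∣_∣ c─S≡⁅a⁆) (∣⁅x⁆∣≡1 a)) ⟩
      k + 1                 ≡⟨ +-comm k 1 ⟩
      suc k                 ∎
    c⊂N-z : c ⊂ N - z
    c⊂N-z = (λ x∈c → x∈p∧x≢y⇒x∈p-y (c⊆N x∈c) λ { refl → x∈p─q⇒x∉q N c z∈N─c x∈c }) ,
            v , x∈p∧x≢y⇒x∈p-y (p─q⊆p N c v∈N─c) (z≢v ∘ sym) , x∈p─q⇒x∉q N c v∈N─c

  edgeThenSingleton : ∀ {S c N w z} → S ⊆ c → Star (c ─ S) → c ⊆ N → N ─ c ≡ ⁅ w ⁆ →
                      z ∈ c ─ S → z ≢ v → w Fin.< z → Replacement S c N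
  edgeThenSingleton {S} {c} {N} {w} {z} S⊆c (sizeK , v∈c─S) c⊆N N─c≡⁅w⁆ z∈c─S z≢v w<z =
    N - z , subst (N - z ⊏_) (N-y≡c c⊆N N─c≡⁅w⁆) (p-x⊏p-y w<z (c⊆N (p─q⊆p c S z∈c─S)) w∈N) ,
    splitOff (⊆-trans S⊆c c⊆N) (c⊆N (p─q⊆p c S z∈c─S)) (x∈p─q⇒x∉q c S z∈c─S) z≢v
      (edge (shrinkEdge size (c─S⊆N─S c⊆N v∈c─S) (c─S⊆N─S c⊆N z∈c─S) z≢v))
    where
    w∈N = p─q⊆p N c (∈singleton N─c≡⁅w⁆)
    size : ∣ N ─ S ∣ ≡ suc k
    size = begin
      ∣ N ─ S ∣             ≡⟨ ∣N─S∣≡∣N─c∣+∣c─S∣ S⊆c c⊆N ⟩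
      ∣ N ─ c ∣ + ∣ c ─ S ∣ ≡⟨ cong₂ _+_ (trans (cong ∣_∣ N─c≡⁅w⁆) (∣⁅x⁆∣≡1 w)) sizeK ⟩
      suc k                 ∎

  afterSingleton : ∀ {S c N a} → S ⊆ c → c ─ S ≡ ⁅ a ⁆ → a ≢ v → FacetStep c N →
                   Replacement S c N ⊎ ∃ λ b → a Fin.< b × b ≢ v × N ─ c ≡ ⁅ b ⁆
  afterSingleton {S} {c} {N} {a} S⊆c c─S≡⁅a⁆ a≢v (c⊆N , singleton {b} b≢v N─c≡⁅b⁆) with <-cmp b a
  ... | tri< b<a _ _ = inj₁ (swapSingletons S⊆c c─S≡⁅a⁆ c⊆N N─c≡⁅b⁆ a≢v b≢v b<a)
  ... | tri≈ _ refl _ = contradiction (p─q⊆p c S (∈singleton c─S≡⁅a⁆)) (x∈p─q⇒x∉q N c (∈singleton N─c≡⁅b⁆))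
  ... | tri> _ _ a<b = inj₂ (b , a<b , b≢v , N─c≡⁅b⁆)
  afterSingleton S⊆c c─S≡⁅a⁆ _ (c⊆N , edge star) = inj₁ (singletonThenEdge S⊆c c─S≡⁅a⁆ c⊆N star)

  Beneath : Fin n → Fin n → Set
  Beneath a z = z Fin.< a ⊎ z ≡ v

  beneath-mono : ∀ {a b z} → a Fin.< b → Beneath a z → Beneath b z
  beneath-mono a<b (inj₁ z<a) = inj₁ (<ᶠ-trans z<a a<b)
  beneath-mono _   (inj₂ z≡v) = inj₂ z≡v

  beneath⇒≢ : ∀ {b z} → b ≢ v → Beneath b z → z ≢ b
  beneath⇒≢ _   (inj₁ z<z) refl = <ᶠ-irrefl refl z<z
  beneath⇒≢ b≢v (inj₂ z≡v) refl = b≢v z≡v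

  -- Scan the singleton blocks following {a} while they increase. The scan ends at a smaller
  -- singleton, which is swapped with its predecessor, or at the edge, which trades an element
  -- with the preceding singleton.
  descend : ∀ {S c rest a z} → S ⊆ c → c ─ S ≡ ⁅ a ⁆ → a ≢ v → FacetPath c ⊤ rest →
            z ∉ c → Beneath a z → ∃ λ r → z ∉ r × Removable S (c ∷ rest) r

  descendPast : ∀ {S c rest b z} → FacetStep S c → FacetPath c ⊤ rest → headOr ⊤ rest ─ c ≡ ⁅ b ⁆ → b ≢ v →
                z ∉ c → Beneath b z → ∃ λ r → z ∉ r × Removable S (c ∷ rest) r

  descend {c = c} S⊆c c─S≡⁅a⁆ a≢v path z∉c beneath with afterSingleton S⊆c c─S≡⁅a⁆ a≢v (firstStep path)
  ... | inj₁ replacement = c , z∉c , removable-head path replacement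
  ... | inj₂ (b , a<b , b≢v , N─c≡⁅b⁆) =
    descendPast (S⊆c , singleton a≢v c─S≡⁅a⁆) path N─c≡⁅b⁆ b≢v z∉c (beneath-mono a<b beneath)

  descendPast _ [ _ ] ⊤─c≡⁅b⁆ b≢v z∉c beneath =
    contradiction (∈singleton⇒≡ ⊤─c≡⁅b⁆ (x∈p∧x∉q⇒x∈p─q ∈⊤ z∉c)) (beneath⇒≢ b≢v beneath)
  descendPast step ((c⊆N , _) ∷ path′) N─c≡⁅b⁆ b≢v z∉c beneath =
    map₂ (map₂ (removable-∷ step)) (descend c⊆N N─c≡⁅b⁆ b≢v path′ z∉N beneath)
    where
    z∉N : _ ∉ _
    z∉N z∈N = beneath⇒≢ b≢v beneath (∈singleton⇒≡ N─c≡⁅b⁆ (x∈p∧x∉q⇒x∈p─q z∈N z∉c))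

  ∉-facetChain : ∀ {c T rest r i} → FacetPath c T rest → i ∈ c → i ∉ r → r ∉ₗ c ∷ rest
  ∉-facetChain _    i∈c i∉r (here refl) = i∉r i∈c
  ∉-facetChain path i∈c i∉r (there r∈)  = i∉r (proj₁ (∈-facetPath⇒⊃ path r∈) i∈c)

  avoiding⇒∉ : ∀ {S F c′ rest′ z} → FacetPath c′ ⊤ rest′ → z ∈ c′ →
               (∃ λ r → z ∉ r × Removable S F r) → ∃ λ r → r ∉ₗ c′ ∷ rest′ × Removable S F r
  avoiding⇒∉ path′ z∈c′ (r , z∉r , removable) = r , ∉-facetChain path′ z∈c′ z∉r , removable

  twoElements⇒edge : ∀ {B x y} → FacetBlock B → x ∈ B → y ∈ B → x ≢ y → Star B
  twoElements⇒edge (singleton _ B≡⁅b⁆) x∈B y∈B x≢y =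
    contradiction (trans (∈singleton⇒≡ B≡⁅b⁆ x∈B) (sym (∈singleton⇒≡ B≡⁅b⁆ y∈B))) x≢y
  twoElements⇒edge (edge star) _ _ _ = star

  pickOutside : ∀ {S c c′ i} → S ⊆ c → Star (c ─ S) → FacetStep S c′ → i ∈ c′ → i ∉ c →
                ∃ λ z → z ∈ c ─ S × z ∉ c′ × z ≢ v
  pickOutside {S} {c} {c′} {i} S⊆c star (_ , singleton _ c′─S≡⁅y⁆) i∈c′ i∉c
    with z , z∈c─S , z≢v ← another star = z , z∈c─S , z∉c′ , z≢v
    where
    z∉c′ : z ∉ c′
    z∉c′ z∈c′ = i∉c (subst (_∈ c) z≡i (p─q⊆p c S z∈c─S))
      where
      z≡i : z ≡ i
      z≡i = trans (∈singleton⇒≡ c′─S≡⁅y⁆ (x∈p∧x∉q⇒x∈p─q z∈c′ (x∈p─q⇒x∉q c S z∈c─S)))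
                  (sym (∈singleton⇒≡ c′─S≡⁅y⁆ (x∈p∧x∉q⇒x∈p─q i∈c′ (i∉c ∘ S⊆c))))
  pickOutside {S} {c} {c′} {i} S⊆c (sizeK , _) (_ , edge (sizeK′ , v∈c′─S)) i∈c′ i∉c
    with nonempty? (c ─ S ─ c′)
  ... | yes (z , z∈) =
    z , p─q⊆p (c ─ S) c′ z∈ , x∈p─q⇒x∉q (c ─ S) c′ z∈ , λ { refl → x∈p─q⇒x∉q (c ─ S) c′ z∈ (p─q⊆p c′ S v∈c′─S) }
  ... | no c─S─c′=∅ = contradiction (p⊂q⇒∣p∣<∣q∣ (c─S⊆c′─S , i , i∈c′─S , i∉c─S)) (<-irrefl (trans sizeK (sym sizeK′)))
    where
    i∈c′─S = x∈p∧x∉q⇒x∈p─q i∈c′ (i∉c ∘ S⊆c)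
    i∉c─S = i∉c ∘ p─q⊆p c S
    c─S⊆c′─S : c ─ S ⊆ c′ ─ S
    c─S⊆c′─S {x} x∈c─S with x ∈? c′
    ... | yes x∈c′ = x∈p∧x∉q⇒x∈p─q x∈c′ (x∈p─q⇒x∉q c S x∈c─S)
    ... | no x∉c′  = contradiction (x , x∈p∧x∉q⇒x∈p─q x∈c─S x∉c′) c─S─c′=∅

  exchangeSingleton : ∀ {S c c′ a rest rest′} → S ⊆ c → c ─ S ≡ ⁅ a ⁆ → a ≢ v → FacetPath c ⊤ rest →
                      FacetStep S c′ → FacetPath c′ ⊤ rest′ → c′ ⊏ c →
                      ∃ λ r → r ∉ₗ c′ ∷ rest′ × Removable S (c ∷ rest) r
  exchangeSingleton {S} {c} {c′} {a} S⊆c c─S≡⁅a⁆ a≢v path (_ , block′) path′ c′⊏c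
    with i , i∈c′ , i∉c , agree ← ⊏⇒firstDifference c′⊏c | <-cmp i a
  ... | tri< i<a _ _ = avoiding⇒∉ path′ i∈c′ (descend S⊆c c─S≡⁅a⁆ a≢v path i∉c (inj₁ i<a))
  ... | tri≈ _ refl _ = contradiction (p─q⊆p c S (∈singleton c─S≡⁅a⁆)) i∉c
  ... | tri> _ _ a<i = avoiding⇒∉ path′ (p─q⊆p c′ S v∈c′─S) (descend S⊆c c─S≡⁅a⁆ a≢v path v∉c (inj₂ refl))
    where
    a∈c─S = ∈singleton c─S≡⁅a⁆
    v∈c′─S : v ∈ c′ ─ S
    v∈c′─S = proj₂ (twoElements⇒edge block′
      (x∈p∧x∉q⇒x∈p─q (agree a<i (p─q⊆p c S a∈c─S)) (x∈p─q⇒x∉q c S a∈c─S))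
      (x∈p∧x∉q⇒x∈p─q i∈c′ (i∉c ∘ S⊆c))
      λ { refl → <ᶠ-irrefl refl a<i })
    v∉c : v ∉ c
    v∉c v∈c = a≢v (sym (∈singleton⇒≡ c─S≡⁅a⁆ (x∈p∧x∉q⇒x∈p─q v∈c (x∈p─q⇒x∉q c′ S v∈c′─S))))

  afterEdge : ∀ {S c N} → Star (c ─ S) → FacetBlock (N ─ c) → ∃ λ w → w ≢ v × N ─ c ≡ ⁅ w ⁆
  afterEdge _ (singleton w≢v N─c≡⁅w⁆) = _ , w≢v , N─c≡⁅w⁆
  afterEdge {S} {c} {N} (_ , v∈c─S) (edge (_ , v∈N─c)) = contradiction (p─q⊆p c S v∈c─S) (x∈p─q⇒x∉q N c v∈N─c)

  exchangeEdge : ∀ {S c c′ rest rest′} → S ⊆ c → Star (c ─ S) → FacetPath c ⊤ rest →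
                 FacetStep S c′ → FacetPath c′ ⊤ rest′ → c′ ⊏ c →
                 ∃ λ r → r ∉ₗ c′ ∷ rest′ × Removable S (c ∷ rest) r
  exchangeEdge {S} {c} {c′} {rest} S⊆c star path step′ path′ c′⊏c
    with i , i∈c′ , i∉c , agree ← ⊏⇒firstDifference c′⊏c
    with z , z∈c─S , z∉c′ , z≢v ← pickOutside S⊆c star step′ i∈c′ i∉c
       | c⊆N , block ← firstStep path
    with w , w≢v , N─c≡⁅w⁆ ← afterEdge {N = headOr ⊤ rest} star block
       | any? (λ z′ → z′ ∈? (c ─ S) ×-dec ¬? (z′ ≟ᶠ v) ×-dec w <? z′)
  ... | yes (z′ , z′∈c─S , z′≢v , w<z′) =
    c , ∉-facetChain path′ i∈c′ i∉c ,
    removable-head path (edgeThenSingleton S⊆c star c⊆N N─c≡⁅w⁆ z′∈c─S z′≢v w<z′)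
  ... | no ∄z′ = avoiding⇒∉ path′ i∈c′
    (descendPast (S⊆c , edge star) path N─c≡⁅w⁆ w≢v i∉c (inj₁ (<ᶠ-trans i<z z<w)))
    where
    i<z : i Fin.< z
    i<z = firstDifference-minimal (i∈c′ , i∉c , agree) (p─q⊆p c S z∈c─S) z∉c′
    z<w : z Fin.< w
    z<w with <-cmp z w
    ... | tri< z<w _ _ = z<w
    ... | tri≈ _ refl _ = contradiction (p─q⊆p c S z∈c─S) (x∈p─q⇒x∉q _ c (∈singleton N─c≡⁅w⁆))
    ... | tri> _ _ w<z = contradiction (z , z∈c─S , z≢v , w<z) ∄z′

  exchange : ∀ {S F F′} → FacetPath S ⊤ F → FacetPath S ⊤ F′ → F′ <ₗ F → ∃ λ r → r ∉ₗ F′ × Removable S F r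
  exchange [ _ ] [ _ ] (base ())
  exchange path@(_ ∷ _) path′@([ _ ]) halt = contradiction (facetPaths-sameLength path path′ ∈⊤) λ ()
  exchange {F = c ∷ _} (step ∷ path) (_ ∷ path′) (next refl later)
    with r , r∉ , removable ← exchange path path′ later = r , r∉c∷rest′ , removable-∷ step removable
    where
    r∉c∷rest′ : r ∉ₗ c ∷ _
    r∉c∷rest′ (here refl) = ⊂-irref refl (∈-facetPath⇒⊃ path (Removable.position removable))
    r∉c∷rest′ (there r∈) = r∉ r∈
  exchange ((S⊆c , singleton a≢v c─S≡⁅a⁆) ∷ path) (step′ ∷ path′) (this c′⊏c) =
    exchangeSingleton S⊆c c─S≡⁅a⁆ a≢v path step′ path′ c′⊏c
  exchange ((S⊆c , edge star) ∷ path) (step′ ∷ path′) (this c′⊏c) =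
    exchangeEdge S⊆c star path step′ path′ c′⊏c

-- The lexicographic shelling

module Shelling {n : ℕ} (k : ℕ) (v : Fin n) (2≤k : 2 ≤ k) where

  open StarFacets k v
  open Exchange k v 2≤k
  open StrictSort {_<_ = _<ₗ_ {n}} <ₗ-cmp <ₗ-trans

  facetBlock? : ∀ B → Dec (FacetBlock B)
  facetBlock? B with any? (λ x → ¬? (x ≟ᶠ v) ×-dec ≡-dec _≟ᵇ_ B ⁅ x ⁆) | (∣ B ∣ ℕ.≟ k) ×-dec (v ∈? B)
  ... | yes (_ , x≢v , B≡⁅x⁆) | _        = yes (singleton x≢v B≡⁅x⁆)
  ... | no _                  | yes star = yes (edge star)
  ... | no ¬singleton         | no ¬star = no λ
    { (singleton x≢v B≡⁅x⁆) → ¬singleton (_ , x≢v , B≡⁅x⁆)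
    ; (edge star)           → ¬star star
    }

  facetStep? : ∀ S c → Dec (FacetStep S c)
  facetStep? S c = (S ⊆? c) ×-dec facetBlock? (c ─ S)

  facetPath? : ∀ S T F → Dec (FacetPath S T F)
  facetPath? S T []      = map′ [_] (λ { [ step ] → step }) (facetStep? S T)
  facetPath? S T (c ∷ F) = map′ (uncurry _∷_) (λ { (step ∷ path) → step , path })
                                (facetStep? S c ×-dec facetPath? c T F)

  chainsOfLength≤n : List (List (Subset n))
  chainsOfLength≤n = listsOfLength≤ (allSubsets n) n

  facets : List (List (Subset n))
  facets = strictSort (filter (facetPath? ⊥ ⊤) chainsOfLength≤n)

  ∈-facets⁻ : ∀ {F} → F ∈ₗ facets → FacetPath ⊥ ⊤ F
  ∈-facets⁻ F∈ = proj₂ (∈-filter⁻ (facetPath? ⊥ ⊤) {xs = chainsOfLength≤n} (Equivalence.to (∈-strictSort _) F∈))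

  ∈-facets⁺ : ∀ {F} → FacetPath ⊥ ⊤ F → F ∈ₗ facets
  ∈-facets⁺ {F} path = Equivalence.from (∈-strictSort _)
    (∈-filter⁺ (facetPath? ⊥ ⊤) (∈-listsOfLength≤ n (All.tabulate λ {c} _ → ∈-allSubsets c) length≤n) path)
    where
    length≤n : length F ≤ n
    length≤n = ≤-trans (m≤m+n (length F) (k + ∣ ⊥ {n} ∣))
                       (≤-reflexive (trans (length-facetPath-∌v path ∉⊥ ∈⊤) (∣⊤∣≡n n)))

  facets-sorted : AllPairs _<ₗ_ facets
  facets-sorted = strictSort-sorted (filter (facetPath? ⊥ ⊤) chainsOfLength≤n)

  shellable : Shellable Star
  shellable = facets , AllPairs.map (λ F<G F≡G → tri⇒irr <ₗ-cmp F≡G F<G) facets-sorted ,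
              All.tabulate (facetPath⇒facet ∘ ∈-facets⁻) , (λ F → ∈-facets⁺ ∘ facet⇒facetPath) , shellSteps
    where
    shellSteps : ∀ pre F post → facets ≡ pre ++ F ∷ post → pre ≢ [] → ShellStep pre F
    shellSteps pre F post facets≡ _ = shellStep-byRemoval removal
      where
      sorted : AllPairs _<ₗ_ (pre ++ F ∷ post)
      sorted = subst (AllPairs _<ₗ_) facets≡ facets-sorted
      ∈-facets≡ : ∀ {G} → G ∈ₗ facets → G ∈ₗ pre ++ F ∷ post
      ∈-facets≡ = subst (_ ∈ₗ_) facets≡
      pathF : FacetPath ⊥ ⊤ F
      pathF = ∈-facets⁻ (subst (F ∈ₗ_) (sym facets≡) (∈-++⁺ʳ pre (here refl)))
      removal : ∀ {F′} → F′ ∈ₗ pre → ∃ λ r → Σ (r ∈ₗ F) λ r∈F → r ∉ₗ F′ × Any ((F Any.─ r∈F) ⊑_) pre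
      removal F′∈pre with r , r∉F′ , removable ←
        exchange pathF (∈-facets⁻ (subst (_ ∈ₗ_) (sym facets≡) (∈-++⁺ˡ F′∈pre))) (AllPairs-before pre sorted F′∈pre) =
        r , position , r∉F′ ,
        lose (sorted⇒before pre sorted (∈-facets≡ (∈-facets⁺ replacement-facetPath)) replacement-earlier) removal-⊑
        where open Removable removable

theorem3p4 : (k n : ℕ) → 3 ≤ k → (H : Hypergraph n) → (v : Fin n) →
    (∀ e → H e ⇔ (∣ e ∣ ≡ k × v ∈ e)) →
    Shellable H
theorem3p4 k n 3≤k H v H⇔Star =
  shellable-resp (λ e → ⇔.sym (H⇔Star e)) (Shelling.shellable k v (≤-trans (n≤1+n 2) 3≤k))
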